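{- There exists an absolute constant $c>0$ such that $v(k)\ge e^{ck^2}$ holds for all positive integers $k$.
   Context: For a positive integer $k$, let $S_k$ denote the set of all $k$-tuples $(n_1,\dots,n_k)$ of integers with $1\le n_1<n_2<\cdots<n_k$ satisfying $1=\frac{1}{n_1}+\cdots+\frac{1}{n_k}$ (pairwise distinct denominators). Let $D_k$ be the set of all integers $m$ such that $m=n_i$ for some $(n_1,\dots,n_k)\in S_k$ and some $1\le i\le k$. Define $v(k)$ to be the smallest integer larger than $1$ that is not contained in $D_k$. -}

module Defs where

open import Data.Nat using (ℕ; zero; suc; _<_; _≤_)
open import Data.Integer using (+_)
open import Data.Rational using (ℚ; _/_; 0ℚ; 1ℚ; _+_)
open import Data.List using (List; []; _∷_; length)
open import Data.List.Relation.Unary.All using (All)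
open import Data.List.Relation.Unary.Linked using (Linked)
open import Data.List.Membership.Propositional using (_∈_)
open import Data.Product using (Σ; _×_)
open import Relation.Binary.PropositionalEquality using (_≡_)
open import Relation.Nullary using (¬_)

-- reciprocal 1/n as a rational; the value at 0 is irrelevant (entries are required ≥ 1)
recip : ℕ → ℚ
recip zero = 0ℚ
recip (suc n) = (+ 1) / suc n

recipSum : List ℕ → ℚ
recipSum [] = 0ℚ
recipSum (n ∷ ns) = recip n + recipSum ns

InS : ℕ → List ℕ → Set
InS k ns = (length ns ≡ k) × All (1 ≤_) ns × Linked _<_ ns × (recipSum ns ≡ 1ℚ)

InD : ℕ → ℕ → Set
InD k m = Σ (List ℕ) λ ns → InS k ns × (m ∈ ns)

IsV : ℕ → ℕ → Set
IsV k v = (1 < v) × ¬ InD k v × (∀ m → 1 < m → m < v → InD k m)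

{-# OPTIONS --safe #-}
module Submission where

-- Let Q = 2 ^ (e + T h) · ∏_{i=1}^{h} (2^i + 1) with T h = 1 + ⋯ + h. Taking 2^i or 2^i + 1 for each i
-- (and a free power of two) gives divisors of Q at every scale with relative gaps about 2^-j
-- above 2^(T j), so greedily subtracting divisors writes every y < 2Q as a sum of at most
-- 4h + e + 1 distinct divisors of Q. If Q < v ≤ 2Q, writing Q - 1 and v - Q this way and
-- multiplying 1 = (Q - 1)/Q + 1/v + (v - Q)/(vQ) out gives a tuple of S_k containing v with
-- k ≤ 8h + 2e + 3, and 1/x = 1/(x + 1) + 1/(x(x + 1)) lengthens it to any larger k.
-- Choosing h maximal keeps e = O(h) while v ≥ 2^(T h), so v ∉ D_k forces k² = O(log v).

open import Defs
open import Data.Nat using (ℕ; zero; suc; _+_; _*_; _^_; _∸_; _≤_; _<_; _>_; z≤n; s≤s; _≤?_; _<?_; _≟_; >-nonZero)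
open import Data.Nat.Properties
open import Data.Nat.Divisibility
  using (_∣_; divides; divides-refl; ∣-refl; ∣-trans; ∣-reflexive; *-pres-∣; *-monoʳ-∣; m∣m*n; n∣m*n; 0∣⇒≡0)
open import Data.Nat.ListAction using (sum; product)
open import Data.Nat.ListAction.Properties using (sum-++; product-++)
open import Data.Nat.Solver using (module +-*-Solver)
open import Data.Product using (Σ; _×_; _,_; proj₁; proj₂)
open import Data.Unit using (⊤; tt)
open import Data.Empty using (⊥-elim)
open import Data.List using (List; []; _∷_; _++_; length; map; replicate)
open import Data.List.Properties using (length-++; length-map; map-++)
open import Data.List.Membership.Propositional.Properties using (∈-++⁺ʳ)
open import Data.List.Relation.Unary.Any using (here)
open import Data.List.Relation.Unary.All as All using (All; []; _∷_; all?)
open import Data.List.Relation.Unary.All.Properties as All using (++⁺; ++⁻ˡ; ++⁻ʳ)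
open import Data.List.Relation.Unary.Linked as Linked using (Linked; []; [-]; _∷_; linked?)
open import Data.List.Relation.Unary.Linked.Properties using (map⁺)
open import Data.List.Relation.Binary.Pointwise as Pointwise using (Pointwise; []; _∷_; Pointwise-length)
import Data.Integer as ℤ
import Data.Integer.Properties as ℤ
open import Data.Rational as ℚ using (_/_; 1ℚ; toℚᵘ)
import Data.Rational.Properties as ℚₚ
open import Data.Rational.Unnormalised as ℚᵘ using (mkℚᵘ; *≡*) renaming (_≃_ to _≃ᵘ_; _+_ to _+ᵘ_)
import Data.Rational.Unnormalised.Properties as ℚᵘₚ
open import Relation.Nullary using (¬_; Dec; yes; no)
open import Relation.Nullary.Decidable using (True; toWitness; _×-dec_)
open import Relation.Binary.PropositionalEquality

open +-*-Solver

*-left-comm : ∀ x y z → x * (y * z) ≡ y * (x * z)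
*-left-comm = solve 3 (λ x y z → x :* (y :* z) := y :* (x :* z)) refl

-- Unit fractions with a common denominator

recipSum-++ : ∀ xs ys → recipSum (xs ++ ys) ≡ recipSum xs ℚ.+ recipSum ys
recipSum-++ []       ys = sym (ℚₚ.+-identityˡ (recipSum ys))
recipSum-++ (x ∷ xs) ys =
  trans (cong (recip x ℚ.+_) (recipSum-++ xs ys)) (sym (ℚₚ.+-assoc (recip x) _ _))

Cofactors : ℕ → List ℕ → List ℕ → Set
Cofactors N = Pointwise (λ d q → d * q ≡ N)

cofactor-positive : ∀ d {q n} → d * q ≡ suc n → 1 ≤ q
cofactor-positive d {zero}  d*0≡N = ⊥-elim (0≢1+n (trans (sym (*-zeroʳ d)) d*0≡N))
cofactor-positive d {suc q} _     = s≤s z≤n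

cofactor-antitone : ∀ {n d d′ q q′} → d * q ≡ suc n → d′ * q′ ≡ suc n → d > d′ → q < q′
cofactor-antitone {d = d} {d′} {q} {q′} dq≡N d′q′≡N d>d′ = *-cancelˡ-< d q q′ (begin-strict
  d * q   ≡⟨ trans dq≡N (sym d′q′≡N) ⟩
  d′ * q′ <⟨ *-monoˡ-< q′ {{>-nonZero (cofactor-positive d′ d′q′≡N)}} {d′} {d} d>d′ ⟩
  d * q′  ∎)
  where open ≤-Reasoning

mkℚᵘ-cross : ∀ {a b c e} → a * suc e ≡ c * suc b → mkℚᵘ (ℤ.+ a) b ≃ᵘ mkℚᵘ (ℤ.+ c) e
mkℚᵘ-cross {a} {b} {c} {e} eq = *≡* (begin
  ℤ.+ a ℤ.* ℤ.+ suc e  ≡⟨ ℤ.pos-* a (suc e) ⟨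
  ℤ.+ (a * suc e)      ≡⟨ cong ℤ.+_ eq ⟩
  ℤ.+ (c * suc b)      ≡⟨ ℤ.pos-* c (suc b) ⟩
  ℤ.+ c ℤ.* ℤ.+ suc b  ∎)
  where open ≡-Reasoning

mkℚᵘ-+ : ∀ a b c e →
         mkℚᵘ (ℤ.+ a) b +ᵘ mkℚᵘ (ℤ.+ c) e ≡ mkℚᵘ (ℤ.+ (a * suc e + c * suc b)) (e + b * suc e)
mkℚᵘ-+ a b c e = cong (λ z → mkℚᵘ z (e + b * suc e)) (sym (begin
  ℤ.+ (a * suc e + c * suc b)                  ≡⟨ ℤ.pos-+ (a * suc e) (c * suc b) ⟩
  ℤ.+ (a * suc e) ℤ.+ ℤ.+ (c * suc b)          ≡⟨ cong₂ ℤ._+_ (ℤ.pos-* a (suc e)) (ℤ.pos-* c (suc b)) ⟩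
  ℤ.+ a ℤ.* ℤ.+ suc e ℤ.+ ℤ.+ c ℤ.* ℤ.+ suc b  ∎))
  where open ≡-Reasoning

cofactor-+ : ∀ {n d q} S → d * suc q ≡ suc n →
             mkℚᵘ (ℤ.+ 1) q +ᵘ mkℚᵘ (ℤ.+ S) n ≃ᵘ mkℚᵘ (ℤ.+ (d + S)) n
cofactor-+ {n} {d} {q} S dq≡N =
  ℚᵘₚ.≃-trans (ℚᵘₚ.≃-reflexive (mkℚᵘ-+ 1 q S n)) (mkℚᵘ-cross (begin
    (1 * suc n + S * suc q) * suc n              ≡⟨ cong (λ N → (1 * N + S * suc q) * N) (sym dq≡N) ⟩
    (1 * (d * suc q) + S * suc q) * (d * suc q)  ≡⟨ expand d (suc q) S ⟩
    (d + S) * (suc q * (d * suc q))              ≡⟨ cong (λ N → (d + S) * (suc q * N)) dq≡N ⟩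
    (d + S) * (suc q * suc n)                    ∎))
  where
  open ≡-Reasoning
  expand : ∀ d q S → (1 * (d * q) + S * q) * (d * q) ≡ (d + S) * (q * (d * q))
  expand = solve 3 (λ d q S → (con 1 :* (d :* q) :+ S :* q) :* (d :* q) := (d :+ S) :* (q :* (d :* q))) refl

toℚᵘ-recipSum : ∀ {n ds qs} → Cofactors (suc n) ds qs → toℚᵘ (recipSum qs) ≃ᵘ mkℚᵘ (ℤ.+ sum ds) n
toℚᵘ-recipSum [] = *≡* refl
toℚᵘ-recipSum (_∷_ {d} {zero} d*0≡N _) = ⊥-elim (n≮0 (cofactor-positive d d*0≡N))
toℚᵘ-recipSum {n} {d ∷ ds} {suc q ∷ qs} (dq≡N ∷ cs) = begin-equality
  toℚᵘ (recip (suc q) ℚ.+ recipSum qs)        ≃⟨ ℚₚ.toℚᵘ-homo-+ (recip (suc q)) (recipSum qs) ⟩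
  toℚᵘ (recip (suc q)) +ᵘ toℚᵘ (recipSum qs)  ≃⟨ ℚᵘₚ.+-cong (ℚₚ.toℚᵘ-fromℚᵘ (mkℚᵘ (ℤ.+ 1) q))
                                                             (toℚᵘ-recipSum cs) ⟩
  mkℚᵘ (ℤ.+ 1) q +ᵘ mkℚᵘ (ℤ.+ sum ds) n       ≃⟨ cofactor-+ (sum ds) dq≡N ⟩
  mkℚᵘ (ℤ.+ (d + sum ds)) n                   ∎
  where open ℚᵘₚ.≤-Reasoning

recipSum-cofactors : ∀ {n ds qs} → Cofactors (suc n) ds qs → recipSum qs ≡ ℤ.+ sum ds / suc n
recipSum-cofactors {n} {ds} cs = ℚₚ.toℚᵘ-injective
  (ℚᵘₚ.≃-trans (toℚᵘ-recipSum cs) (ℚᵘₚ.≃-sym (ℚₚ.toℚᵘ-fromℚᵘ (mkℚᵘ (ℤ.+ sum ds) n))))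

recipSum-cofactors-cong : ∀ {n ds qs ds′ qs′} → Cofactors (suc n) ds qs → Cofactors (suc n) ds′ qs′ →
                          sum ds ≡ sum ds′ → recipSum qs ≡ recipSum qs′
recipSum-cofactors-cong cs cs′ eq =
  trans (recipSum-cofactors cs) (trans (cong (λ s → ℤ.+ s / _) eq) (sym (recipSum-cofactors cs′)))

cofactors-InS : ∀ {n ds qs} → Cofactors (suc n) ds qs → Linked _>_ ds → sum ds ≡ suc n →
                InS (length ds) qs
cofactors-InS {n} {ds} {qs} cs desc sum≡N = sym (Pointwise-length cs) , positive cs , ascending cs desc , sum≡1
  where
  positive : ∀ {ds qs} → Cofactors (suc n) ds qs → All (1 ≤_) qs
  positive []             = []
  positive (_∷_ {d} c cs) = cofactor-positive d c ∷ positive cs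
  ascending : ∀ {ds qs} → Cofactors (suc n) ds qs → Linked _>_ ds → Linked _<_ qs
  ascending []            []          = []
  ascending (_ ∷ [])      [-]         = [-]
  ascending (c ∷ c′ ∷ cs) (d>d′ ∷ ds) = cofactor-antitone c c′ d>d′ ∷ ascending (c′ ∷ cs) ds
  sum≡1 : recipSum qs ≡ 1ℚ
  sum≡1 = recipSum-cofactors-cong cs (*-identityʳ (suc n) ∷ []) (trans sum≡N (sym (+-identityʳ (suc n))))

cofactors : ∀ {N ds} → All (_∣ N) ds → Σ (List ℕ) (Cofactors N ds)
cofactors [] = [] , []
cofactors {ds = d ∷ _} (divides q N≡q*d ∷ ds∣N) =
  q ∷ proj₁ (cofactors ds∣N) , trans (*-comm d q) (sym N≡q*d) ∷ proj₂ (cofactors ds∣N)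

cofactors-*ˡ : ∀ m {N ds qs} → Cofactors N ds qs → Cofactors (m * N) (map (m *_) ds) qs
cofactors-*ˡ m []                    = []
cofactors-*ˡ m (_∷_ {d} {q} dq≡N cs) = trans (*-assoc m d q) (cong (m *_) dq≡N) ∷ cofactors-*ˡ m cs

cofactors-*ʳ : ∀ m {N ds qs} → Cofactors N ds qs → Cofactors (m * N) ds (map (m *_) qs)
cofactors-*ʳ m []                    = []
cofactors-*ʳ m (_∷_ {d} {q} dq≡N cs) = trans (*-left-comm d m q) (cong (m *_) dq≡N) ∷ cofactors-*ʳ m cs

-- Lengthening a tuple

linked-++⁻ʳ : ∀ {R : ℕ → ℕ → Set} xs {ys} → Linked R (xs ++ ys) → Linked R ys
linked-++⁻ʳ []       lk = lk
linked-++⁻ʳ (x ∷ xs) lk = linked-++⁻ʳ xs (Linked.tail lk)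

linked-++-∷ : ∀ {R : ℕ → ℕ → Set} xs {y ys} → Linked R xs → All (λ x → R x y) xs → Linked R (y ∷ ys) →
              Linked R (xs ++ y ∷ ys)
linked-++-∷ []            _            _          lk = lk
linked-++-∷ (x ∷ [])      _            (Rxy ∷ []) lk = Rxy ∷ lk
linked-++-∷ (x ∷ x′ ∷ xs) (Rxx′ ∷ lk′) (_ ∷ Rxsy) lk = Rxx′ ∷ linked-++-∷ (x′ ∷ xs) lk′ Rxsy lk

linked-swap-suffix : ∀ {R : ℕ → ℕ → Set} xs {y ys zs} → Linked R (xs ++ y ∷ ys) → Linked R (y ∷ zs) →
                     Linked R (xs ++ y ∷ zs)
linked-swap-suffix []            _            lk = lk
linked-swap-suffix (x ∷ [])      (Rxy ∷ _)    lk = Rxy ∷ lk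
linked-swap-suffix (x ∷ x′ ∷ xs) (Rxx′ ∷ lk′) lk = Rxx′ ∷ linked-swap-suffix (x′ ∷ xs) lk′ lk

splitLast : List ℕ → List ℕ
splitLast []           = []
splitLast (x ∷ [])     = suc x ∷ x * suc x ∷ []
splitLast (x ∷ y ∷ ys) = x ∷ splitLast (y ∷ ys)

length-splitLast : ∀ x xs → length (splitLast (x ∷ xs)) ≡ suc (length (x ∷ xs))
length-splitLast x []       = refl
length-splitLast x (y ∷ ys) = cong suc (length-splitLast y ys)

splitLast-positive : ∀ {xs} → All (1 ≤_) xs → All (1 ≤_) (splitLast xs)
splitLast-positive []                         = []
splitLast-positive {x ∷ []}     (x≥1 ∷ [])   = s≤s z≤n ∷ *-mono-≤ x≥1 (s≤s z≤n) ∷ []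
splitLast-positive {x ∷ y ∷ ys} (x≥1 ∷ ys≥1) = x≥1 ∷ splitLast-positive ys≥1

recipSum-splitLast : ∀ {xs} → All (1 ≤_) xs → recipSum (splitLast xs) ≡ recipSum xs
recipSum-splitLast []                       = refl
recipSum-splitLast {suc x ∷ []}  (_ ∷ [])   =
  recipSum-cofactors-cong {ds = suc x ∷ 1 ∷ []} {qs = suc (suc x) ∷ suc x * suc (suc x) ∷ []}
                          {ds′ = suc (suc x) ∷ []} {qs′ = suc x ∷ []}
                          (refl ∷ *-identityˡ _ ∷ []) (*-comm (suc (suc x)) (suc x) ∷ []) (+-suc (suc x) 0)
recipSum-splitLast {x ∷ y ∷ ys} (_ ∷ ys≥1) = cong (recip x ℚ.+_) (recipSum-splitLast ys≥1)

splitLast-ascending : ∀ {x xs} → 1 ≤ x → Linked _<_ (x ∷ xs) → Linked _<_ (x ∷ splitLast xs)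
splitLast-ascending _ [-] = [-]
splitLast-ascending {x} {y ∷ []} x≥1 (x<y ∷ [-]) = m<n⇒m<1+n x<y ∷ suc-y<y*suc-y ∷ [-]
  where
  suc-y<y*suc-y : suc y < y * suc y
  suc-y<y*suc-y = subst (_< y * suc y) (*-identityˡ (suc y)) (*-monoˡ-< (suc y) (≤-<-trans x≥1 x<y))
splitLast-ascending {xs = y ∷ z ∷ zs} x≥1 (x<y ∷ y<zs) =
  x<y ∷ splitLast-ascending (≤-trans x≥1 (<⇒≤ x<y)) y<zs

-- Entries other than the largest survive splitting the largest entry, so InD⁺ is monotone in k.
InD⁺ : ℕ → ℕ → Set
InD⁺ k m = Σ (List ℕ) λ pre → Σ (List ℕ) λ post → InS k (pre ++ m ∷ post) × 1 ≤ length post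

InD⁺⇒InD : ∀ {k m} → InD⁺ k m → InD k m
InD⁺⇒InD (pre , post , s , _) = pre ++ _ ∷ post , s , ∈-++⁺ʳ pre (here refl)

InD⁺-suc : ∀ {k m} → InD⁺ k m → InD⁺ (suc k) m
InD⁺-suc {k} {m} (pre , post@(y ∷ ys) , (len , pos , asc , sum≡1) , _) =
  pre , splitLast post , (len′ , pos′ , asc′ , sum≡1′) ,
  subst (1 ≤_) (sym (length-splitLast y ys)) (s≤s z≤n)
  where
  open ≡-Reasoning
  m≥1 : 1 ≤ m
  m≥1 = All.head (++⁻ʳ pre pos)
  post≥1 : All (1 ≤_) post
  post≥1 = All.tail (++⁻ʳ pre pos)
  len′ : length (pre ++ m ∷ splitLast post) ≡ suc k
  len′ = begin
    length (pre ++ m ∷ splitLast post)          ≡⟨ length-++ pre ⟩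
    length pre + suc (length (splitLast post))  ≡⟨ cong (λ n → length pre + suc n) (length-splitLast y ys) ⟩
    length pre + suc (suc (length post))        ≡⟨ +-suc (length pre) _ ⟩
    suc (length pre + length (m ∷ post))        ≡⟨ cong suc (length-++ pre) ⟨
    suc (length (pre ++ m ∷ post))              ≡⟨ cong suc len ⟩
    suc k                                       ∎
  pos′ : All (1 ≤_) (pre ++ m ∷ splitLast post)
  pos′ = ++⁺ (++⁻ˡ pre pos) (m≥1 ∷ splitLast-positive post≥1)
  asc′ : Linked _<_ (pre ++ m ∷ splitLast post)
  asc′ = linked-swap-suffix pre asc (splitLast-ascending m≥1 (linked-++⁻ʳ pre asc))
  sum≡1′ : recipSum (pre ++ m ∷ splitLast post) ≡ 1ℚ
  sum≡1′ = begin
    recipSum (pre ++ m ∷ splitLast post)                      ≡⟨ recipSum-++ pre _ ⟩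
    recipSum pre ℚ.+ (recip m ℚ.+ recipSum (splitLast post))  ≡⟨ cong (λ r → recipSum pre ℚ.+ (recip m ℚ.+ r))
                                                                      (recipSum-splitLast post≥1) ⟩
    recipSum pre ℚ.+ recipSum (m ∷ post)                      ≡⟨ recipSum-++ pre _ ⟨
    recipSum (pre ++ m ∷ post)                                ≡⟨ sum≡1 ⟩
    1ℚ                                                        ∎

InD⁺-+ : ∀ {k m} p → InD⁺ k m → InD⁺ (p + k) m
InD⁺-+ zero    d = d
InD⁺-+ (suc p) d = InD⁺-suc (InD⁺-+ p d)

InD⁺-mono : ∀ {k k′ m} → k ≤ k′ → InD⁺ k m → InD⁺ k′ m
InD⁺-mono {k} {k′} k≤k′ d = subst (λ n → InD⁺ n _) (m∸n+n≡m k≤k′) (InD⁺-+ (k′ ∸ k) d)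

-- Sums of distinct divisors

record DivisorSum (Q n y : ℕ) : Set where
  field
    divisors   : List ℕ
    descending : Linked _>_ divisors
    all∣Q      : All (_∣ Q) divisors
    length≤    : length divisors ≤ n
    sum≡       : sum divisors ≡ y

open DivisorSum

All-≤-sum : ∀ xs → All (_≤ sum xs) xs
All-≤-sum []       = []
All-≤-sum (x ∷ xs) = m≤m+n x (sum xs) ∷ All.map (λ y≤ → ≤-trans y≤ (m≤n+m (sum xs) x)) (All-≤-sum xs)

divisors-≤ : ∀ {Q n y} (S : DivisorSum Q n y) → All (_≤ y) (divisors S)
divisors-≤ S = subst (λ s → All (_≤ s) (divisors S)) (sum≡ S) (All-≤-sum (divisors S))

∷-descending : ∀ {d ds} → Linked _>_ ds → All (_< d) ds → Linked _>_ (d ∷ ds)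
∷-descending []   []         = [-]
∷-descending desc (d′<d ∷ _) = d′<d ∷ desc

divisorSum-weaken : ∀ {Q n n′ y} → n ≤ n′ → DivisorSum Q n y → DivisorSum Q n′ y
divisorSum-weaken n≤n′ S = record
  { divisors = divisors S ; descending = descending S ; all∣Q = all∣Q S
  ; length≤ = ≤-trans (length≤ S) n≤n′ ; sum≡ = sum≡ S }

divisorSum-∷ : ∀ {Q n y d} → d ∣ Q → y < d → DivisorSum Q n y → DivisorSum Q (suc n) (d + y)
divisorSum-∷ {d = d} d∣Q y<d S = record
  { divisors   = d ∷ divisors S
  ; descending = ∷-descending (descending S) (All.map (λ x≤y → ≤-<-trans x≤y y<d) (divisors-≤ S))
  ; all∣Q      = d∣Q ∷ all∣Q S
  ; length≤    = s≤s (length≤ S)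
  ; sum≡       = cong (_+_ d) (sum≡ S)
  }

divisor-positive : ∀ {d Q} → 1 ≤ Q → d ∣ Q → 1 ≤ d
divisor-positive {zero}  Q≥1 0∣Q = ⊥-elim (<⇒≢ Q≥1 (sym (0∣⇒≡0 0∣Q)))
divisor-positive {suc d} _   _   = s≤s z≤n

descending-join : ∀ {Q m ds₁ ds₂} → 1 ≤ Q → Q < m → Linked _>_ ds₁ → All (_∣ Q) ds₁ →
                  Linked _>_ ds₂ → All (_< Q) ds₂ → Linked _>_ (map (m *_) ds₁ ++ Q ∷ ds₂)
descending-join {Q} {m} {ds₁} Q≥1 Q<m desc₁ ds₁∣Q desc₂ ds₂<Q =
  linked-++-∷ (map (m *_) ds₁) (map⁺ (Linked.map (*-monoʳ-< m {{>-nonZero m≥1}}) desc₁))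
              (All.map⁺ (All.map md>Q ds₁∣Q)) (∷-descending desc₂ ds₂<Q)
  where
  m≥1 : 1 ≤ m
  m≥1 = ≤-<-trans z≤n Q<m
  md>Q : ∀ {d} → d ∣ Q → m * d > Q
  md>Q d∣Q = <-≤-trans Q<m (m≤m*n m _ {{>-nonZero (divisor-positive Q≥1 d∣Q)}})

sum-map-* : ∀ m xs → sum (map (m *_) xs) ≡ m * sum xs
sum-map-* m []       = sym (*-zeroʳ m)
sum-map-* m (x ∷ xs) = trans (cong (_+_ (m * x)) (sum-map-* m xs)) (sym (*-distribˡ-+ m x (sum xs)))

sum-join : ∀ {Q m} → 1 ≤ Q → Q ≤ m → m * (Q ∸ 1) + (Q + (m ∸ Q)) ≡ m * Q
sum-join {suc Q} {m} _ Q≤m = begin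
  m * Q + (suc Q + (m ∸ suc Q))  ≡⟨ cong (_+_ (m * Q)) (m+[n∸m]≡n Q≤m) ⟩
  m * Q + m                      ≡⟨ +-comm (m * Q) m ⟩
  m + m * Q                      ≡⟨ *-suc m Q ⟨
  m * suc Q                      ∎
  where open ≡-Reasoning

nonempty-of-sum : ∀ xs → 1 ≤ sum xs → 1 ≤ length xs
nonempty-of-sum (x ∷ _) _ = s≤s z≤n

-- m Q = m (Q - 1) + Q + (m - Q) is a sum of distinct divisors of m Q, and the divisor Q has cofactor m.
InD⁺-from-divisorSums : ∀ {Q m n₁ n₂} → 1 ≤ Q → Q < m →
                        (S₁ : DivisorSum Q n₁ (Q ∸ 1)) (S₂ : DivisorSum Q n₂ (m ∸ Q)) →
                        All (_< Q) (divisors S₂) → InD⁺ (n₁ + suc n₂) m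
InD⁺-from-divisorSums {Q@(suc _)} {m@(suc _)} {n₁} {n₂} Q≥1 Q<m S₁ S₂ ds₂<Q =
  InD⁺-mono len≤ (A , map (m *_) B , cofactors-InS cs desc total , post≥1)
  where
  ds₁ = divisors S₁
  ds₂ = divisors S₂
  A = proj₁ (cofactors (all∣Q S₁))
  B = proj₁ (cofactors (all∣Q S₂))
  ds = map (m *_) ds₁ ++ Q ∷ ds₂
  cs : Cofactors (m * Q) ds (A ++ m ∷ map (m *_) B)
  cs = Pointwise.++⁺ (cofactors-*ˡ m (proj₂ (cofactors (all∣Q S₁))))
                     (*-comm Q m ∷ cofactors-*ʳ m (proj₂ (cofactors (all∣Q S₂))))
  desc : Linked _>_ ds
  desc = descending-join Q≥1 Q<m (descending S₁) (all∣Q S₁) (descending S₂) ds₂<Q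
  total : sum ds ≡ m * Q
  total = begin
    sum ds                                ≡⟨ sum-++ (map (m *_) ds₁) (Q ∷ ds₂) ⟩
    sum (map (m *_) ds₁) + (Q + sum ds₂)  ≡⟨ cong₂ (λ a b → a + (Q + b)) (sum-map-* m ds₁) (sum≡ S₂) ⟩
    m * sum ds₁ + (Q + (m ∸ Q))           ≡⟨ cong (λ a → m * a + (Q + (m ∸ Q))) (sum≡ S₁) ⟩
    m * (Q ∸ 1) + (Q + (m ∸ Q))           ≡⟨ sum-join Q≥1 (<⇒≤ Q<m) ⟩
    m * Q                                 ∎
    where open ≡-Reasoning
  len≤ : length ds ≤ n₁ + suc n₂
  len≤ = subst (_≤ n₁ + suc n₂)
               (sym (trans (length-++ (map (m *_) ds₁)) (cong (_+ suc (length ds₂)) (length-map (m *_) ds₁))))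
               (+-mono-≤ (length≤ S₁) (s≤s (length≤ S₂)))
  post≥1 : 1 ≤ length (map (m *_) B)
  post≥1 = subst (1 ≤_) (trans (Pointwise-length (proj₂ (cofactors (all∣Q S₂)))) (sym (length-map (m *_) B)))
                 (nonempty-of-sum ds₂ (subst (1 ≤_) (sym (sum≡ S₂)) (m<n⇒0<n∸m Q<m)))

DenseDivisors : ℕ → ℕ → ℕ → ℕ → Set
DenseDivisors M a L U = ∀ y → L ≤ y → y < U → Σ ℕ λ d → d ∣ M × d ≤ y × a * y < suc a * d

dense-weaken : ∀ {M M′ a L L′ U U′} → M ∣ M′ → L ≤ L′ → U′ ≤ U →
               DenseDivisors M a L U → DenseDivisors M′ a L′ U′
dense-weaken M∣M′ L≤L′ U′≤U dense y lo hi =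
  let d , d∣M , close = dense y (≤-trans L≤L′ lo) (<-≤-trans hi U′≤U) in d , ∣-trans d∣M M∣M′ , close

remainder-bounds : ∀ {a d y} → 1 ≤ a → d ≤ y → a * y < suc a * d → suc a * (y ∸ d) < y × y ∸ d < d
remainder-bounds {a} {d} {y} a≥1 d≤y close = shrink , ≤-<-trans (m≤n*m (y ∸ d) a {{>-nonZero a≥1}}) ar<d
  where
  open ≤-Reasoning
  d+r≡y : d + (y ∸ d) ≡ y
  d+r≡y = m+[n∸m]≡n d≤y
  ar<d : a * (y ∸ d) < d
  ar<d = +-cancelˡ-< (a * d) _ _ (begin-strict
    a * d + a * (y ∸ d)  ≡⟨ *-distribˡ-+ a d (y ∸ d) ⟨
    a * (d + (y ∸ d))    ≡⟨ cong (a *_) d+r≡y ⟩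
    a * y                <⟨ close ⟩
    d + a * d            ≡⟨ +-comm d (a * d) ⟩
    a * d + d            ∎)
  shrink : suc a * (y ∸ d) < y
  shrink = begin-strict
    (y ∸ d) + a * (y ∸ d)  <⟨ +-monoʳ-< (y ∸ d) ar<d ⟩
    (y ∸ d) + d            ≡⟨ +-comm (y ∸ d) d ⟩
    d + (y ∸ d)            ≡⟨ d+r≡y ⟩
    y                      ∎

-- Each step subtracts a divisor d with y - d < y / (a + 1), so r steps cover [L, L (a + 1) ^ r).
greedy : ∀ {Q a L U n} → 1 ≤ a → DenseDivisors Q a L U → (∀ y → y < L → DivisorSum Q n y) →
         ∀ r y → y < U → y < L * suc a ^ r → DivisorSum Q (n + r) y
greedy {n = n} _ _ below zero y _ y<L =
  divisorSum-weaken (m≤m+n n 0) (below y (subst (y <_) (*-identityʳ _) y<L))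
greedy {Q} {a} {L} {U} {n} a≥1 dense below (suc r) y y<U y<L·aʳ with L ≤? y
... | no  y≱L = divisorSum-weaken (m≤m+n n (suc r)) (below y (≰⇒> y≱L))
... | yes L≤y with dense y L≤y y<U
...   | d , d∣Q , d≤y , close =
  subst₂ (DivisorSum Q) (sym (+-suc n r)) (m+[n∸m]≡n d≤y)
    (divisorSum-∷ d∣Q (proj₂ bounds)
      (greedy a≥1 dense below r (y ∸ d) (≤-<-trans (m∸n≤m y d) y<U) rest<L·aʳ))
  where
  bounds = remainder-bounds a≥1 d≤y close
  rest<L·aʳ : y ∸ d < L * suc a ^ r
  rest<L·aʳ = *-cancelˡ-< (suc a) _ _ (<-≤-trans (proj₁ bounds)
                (≤-trans (<⇒≤ y<L·aʳ) (≤-reflexive (*-left-comm L (suc a) (suc a ^ r)))))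

-- Products of choices x or x + 1

Balanced : ℕ → List ℕ → Set
Balanced a []       = ⊤
Balanced a (x ∷ xs) = a * (suc x * product xs) ≤ suc a * (x * product (map suc xs)) × Balanced a xs

choice-∣ : ∀ f {G} x P P⁺ → f ∣ x * suc x → G ∣ P * P⁺ → f * G ∣ x * P * (suc x * P⁺)
choice-∣ f {G} x P P⁺ f∣ G∣ = subst (f * G ∣_) (rearrange x P P⁺) (*-pres-∣ f∣ G∣)
  where
  rearrange : ∀ x P P⁺ → x * suc x * (P * P⁺) ≡ x * P * (suc x * P⁺)
  rearrange = solve 3 (λ x P P⁺ → x :* (con 1 :+ x) :* (P :* P⁺) := x :* P :* ((con 1 :+ x) :* P⁺)) refl

-- Scanning the entries in order and taking the factor x + 1 whenever that stays below y keeps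
-- c G ≤ y < (1 + 1/a) c G⁺, where G⁺ is G with all remaining factors taken as x + 1.
balanced-choice : ∀ {a} → 1 ≤ a → ∀ xs → Balanced a xs → ∀ c {y} →
                  c * product xs ≤ y → a * y < suc a * (c * product (map suc xs)) →
                  Σ ℕ λ G → G ∣ product xs * product (map suc xs) × c * G ≤ y × a * y < suc a * (c * G)
balanced-choice a≥1 [] _ c lo hi = 1 , ∣-refl , lo , hi
balanced-choice {a} a≥1 (x ∷ xs) (head , bal) c {y} lo hi with c * suc x * product xs ≤? y
... | yes up =
  let G , G∣ , lo′ , hi′ = balanced-choice a≥1 xs bal (c * suc x) up
                             (subst (λ z → a * y < suc a * z) (sym (*-assoc c (suc x) _)) hi)
  in suc x * G , choice-∣ (suc x) x (product xs) _ (n∣m*n x) G∣ ,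
     subst (_≤ y) (*-assoc c (suc x) G) lo′ , subst (λ z → a * y < suc a * z) (*-assoc c (suc x) G) hi′
... | no down =
  let G , G∣ , lo′ , hi′ = balanced-choice a≥1 xs bal (c * x) (subst (_≤ y) (sym (*-assoc c x _)) lo) hi″
  in x * G , choice-∣ x x (product xs) _ (m∣m*n (suc x)) G∣ ,
     subst (_≤ y) (*-assoc c x G) lo′ , subst (λ z → a * y < suc a * z) (*-assoc c x G) hi′
  where
  open ≤-Reasoning
  hi″ : a * y < suc a * (c * x * product (map suc xs))
  hi″ = begin-strict
    a * y                                     <⟨ *-monoʳ-< a {{>-nonZero a≥1}} (≰⇒> down) ⟩
    a * (c * suc x * product xs)              ≡⟨ cong (a *_) (*-assoc c (suc x) _) ⟩
    a * (c * (suc x * product xs))            ≡⟨ *-left-comm a c _ ⟩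
    c * (a * (suc x * product xs))            ≤⟨ *-monoʳ-≤ c head ⟩
    c * (suc a * (x * product (map suc xs)))  ≡⟨ *-left-comm c (suc a) _ ⟩
    suc a * (c * (x * product (map suc xs)))  ≡⟨ cong (suc a *_) (*-assoc c x _) ⟨
    suc a * (c * x * product (map suc xs))    ∎

product-ones : ∀ f xs → product (replicate f 1 ++ xs) ≡ product xs
product-ones zero    xs = refl
product-ones (suc f) xs = trans (*-identityˡ _) (product-ones f xs)

product-suc-ones : ∀ f xs → product (map suc (replicate f 1 ++ xs)) ≡ 2 ^ f * product (map suc xs)
product-suc-ones zero    xs = sym (*-identityˡ _)
product-suc-ones (suc f) xs = trans (cong (2 *_) (product-suc-ones f xs)) (sym (*-assoc 2 (2 ^ f) _))

balanced-ones : ∀ {a xs} → Balanced a (1 ∷ xs) → ∀ f → Balanced a (replicate f 1 ++ xs)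
balanced-ones (_ , bal) zero = bal
balanced-ones {a} {xs} bal₁@(head , _) (suc f) = head′ , balanced-ones bal₁ f
  where
  open ≤-Reasoning
  head′ : a * (2 * product (replicate f 1 ++ xs)) ≤ suc a * (1 * product (map suc (replicate f 1 ++ xs)))
  head′ = begin
    a * (2 * product (replicate f 1 ++ xs))                ≡⟨ cong (λ p → a * (2 * p)) (product-ones f xs) ⟩
    a * (2 * product xs)                                   ≤⟨ head ⟩
    suc a * (1 * product (map suc xs))                     ≤⟨ *-monoʳ-≤ (suc a)
                                                                (*-monoʳ-≤ 1 (m≤n*m _ (2 ^ f) {{m^n≢0 2 f}})) ⟩
    suc a * (1 * (2 ^ f * product (map suc xs)))           ≡⟨ cong (λ p → suc a * (1 * p)) (product-suc-ones f xs) ⟨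
    suc a * (1 * product (map suc (replicate f 1 ++ xs)))  ∎

-- Dense divisors of Q

powersOf2 : ℕ → ℕ → List ℕ
powersOf2 i zero    = []
powersOf2 i (suc n) = 2 ^ i ∷ powersOf2 (suc i) n

-- Prepending x to a list starting with 2x multiplies the ratio by 4x(x + 1)/(2x + 1)² < 1.
balanced-doubling : ∀ H x A B → H * (suc (2 * x) * A) ≤ suc H * (2 * x * B) →
                    H * (suc x * (2 * x * A)) ≤ suc H * (x * (suc (2 * x) * B))
balanced-doubling H x A B hyp = *-cancelʳ-≤ _ _ (suc (2 * x)) (begin
  H * (suc x * (2 * x * A)) * suc (2 * x)        ≡⟨ ring₁ H x A ⟩
  2 * x * suc x * (H * (suc (2 * x) * A))        ≤⟨ *-monoʳ-≤ (2 * x * suc x) hyp ⟩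
  2 * x * suc x * (suc H * (2 * x * B))          ≡⟨ ring₂ H x B ⟩
  suc H * B * (4 * x * x * suc x)                ≤⟨ *-monoʳ-≤ (suc H * B) (m≤m+n _ x) ⟩
  suc H * B * (4 * x * x * suc x + x)            ≡⟨ ring₃ H x B ⟩
  suc H * (x * (suc (2 * x) * B)) * suc (2 * x)  ∎)
  where
  open ≤-Reasoning
  ring₁ : ∀ H x A → H * (suc x * (2 * x * A)) * suc (2 * x) ≡ 2 * x * suc x * (H * (suc (2 * x) * A))
  ring₁ = solve 3 (λ H x A → H :* ((con 1 :+ x) :* (con 2 :* x :* A)) :* (con 1 :+ con 2 :* x)
                          := con 2 :* x :* (con 1 :+ x) :* (H :* ((con 1 :+ con 2 :* x) :* A))) refl
  ring₂ : ∀ H x B → 2 * x * suc x * (suc H * (2 * x * B)) ≡ suc H * B * (4 * x * x * suc x)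
  ring₂ = solve 3 (λ H x B → con 2 :* x :* (con 1 :+ x) :* ((con 1 :+ H) :* (con 2 :* x :* B))
                          := (con 1 :+ H) :* B :* (con 4 :* x :* x :* (con 1 :+ x))) refl
  ring₃ : ∀ H x B → suc H * B * (4 * x * x * suc x + x) ≡ suc H * (x * (suc (2 * x) * B)) * suc (2 * x)
  ring₃ = solve 3 (λ H x B → (con 1 :+ H) :* B :* (con 4 :* x :* x :* (con 1 :+ x) :+ x)
                          := (con 1 :+ H) :* (x :* ((con 1 :+ con 2 :* x) :* B)) :* (con 1 :+ con 2 :* x)) refl

balanced-powersOf2 : ∀ n i → Balanced (2 ^ (i + n)) (powersOf2 i (suc n))
balanced-powersOf2 zero    i rewrite +-identityʳ i = ≤-reflexive (*-left-comm (2 ^ i) (suc (2 ^ i)) 1) , tt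
balanced-powersOf2 (suc n) i rewrite +-suc i n with balanced-powersOf2 n (suc i)
... | head , tail = balanced-doubling (2 ^ suc (i + n)) (2 ^ i) _ _ head , head , tail

T : ℕ → ℕ
T zero    = 0
T (suc j) = T j + suc j

T-mono : ∀ {i j} → i ≤ j → T i ≤ T j
T-mono {zero}          _         = z≤n
T-mono {suc i} {suc j} (s≤s i≤j) = +-mono-≤ (T-mono i≤j) (s≤s i≤j)

powersOf2-++ : ∀ i m n → powersOf2 i (m + n) ≡ powersOf2 i m ++ powersOf2 (i + m) n
powersOf2-++ i zero    n = cong (λ k → powersOf2 k n) (sym (+-identityʳ i))
powersOf2-++ i (suc m) n = cong (2 ^ i ∷_) (trans (powersOf2-++ (suc i) m n)
                             (cong (λ k → powersOf2 (suc i) m ++ powersOf2 k n) (sym (+-suc i m))))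

product-powersOf2 : ∀ j → product (powersOf2 1 j) ≡ 2 ^ T j
product-powersOf2 zero    = refl
product-powersOf2 (suc j) = begin
  product (powersOf2 1 (suc j))              ≡⟨ cong (λ n → product (powersOf2 1 n)) (+-comm 1 j) ⟩
  product (powersOf2 1 (j + 1))              ≡⟨ cong product (powersOf2-++ 1 j 1) ⟩
  product (powersOf2 1 j ++ 2 ^ suc j ∷ [])  ≡⟨ product-++ (powersOf2 1 j) _ ⟩
  product (powersOf2 1 j) * (2 ^ suc j * 1)  ≡⟨ cong₂ _*_ (product-powersOf2 j) (*-identityʳ _) ⟩
  2 ^ T j * 2 ^ suc j                        ≡⟨ ^-distribˡ-+-* 2 (T j) (suc j) ⟨
  2 ^ (T j + suc j)                          ∎
  where open ≡-Reasoning

oddPart : ℕ → ℕ → ℕ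
oddPart i n = product (map suc (powersOf2 i n))

oddPart-+ : ∀ i m n → oddPart i (m + n) ≡ oddPart i m * oddPart (i + m) n
oddPart-+ i m n = begin
  product (map suc (powersOf2 i (m + n)))                             ≡⟨ cong (λ xs → product (map suc xs))
                                                                             (powersOf2-++ i m n) ⟩
  product (map suc (powersOf2 i m ++ powersOf2 (i + m) n))            ≡⟨ cong product (map-++ suc (powersOf2 i m) _) ⟩
  product (map suc (powersOf2 i m) ++ map suc (powersOf2 (i + m) n))  ≡⟨ product-++ (map suc (powersOf2 i m)) _ ⟩
  oddPart i m * oddPart (i + m) n                                     ∎
  where open ≡-Reasoning

oddPart-∣ : ∀ {j h} → j ≤ h → oddPart 1 j ∣ oddPart 1 h
oddPart-∣ {j} {h} j≤h =
  subst (oddPart 1 j ∣_) (trans (sym (oddPart-+ 1 j (h ∸ j))) (cong (oddPart 1) (m+[n∸m]≡n j≤h))) (m∣m*n _)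

oddPart-positive : ∀ i n → 1 ≤ oddPart i n
oddPart-positive i zero    = ≤-refl
oddPart-positive i (suc n) = *-mono-≤ {1} {suc (2 ^ i)} (s≤s z≤n) (oddPart-positive (suc i) n)

-- The E ∸ T j leading ones let the choice also pick any power of two up to 2 ^ (E ∸ T j).
approx : ∀ {E} j W → T j ≤ E →
         DenseDivisors (2 ^ E * (oddPart 1 j * W)) (2 ^ j) (2 ^ T j * W) (2 ^ suc E * W)
approx {E} j W Tj≤E y lo hi =
  let G , G∣ , lo′ , hi′ = balanced-choice (m^n>0 2 j) xs (balanced-ones (balanced-powersOf2 j 0) f) W lo″ hi″
  in W * G , subst (W * G ∣_) divisor-bound (*-monoʳ-∣ W G∣) , lo′ , hi′
  where
  open ≤-Reasoning
  ring₁ : ∀ a F P W → a * (2 * (F * P) * W) ≡ F * W * (a * (2 * P))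
  ring₁ = solve 4 (λ a F P W → a :* (con 2 :* (F :* P) :* W) := F :* W :* (a :* (con 2 :* P))) refl
  ring₂ : ∀ b F W O → F * W * (b * (1 * O)) ≡ b * (W * (F * O))
  ring₂ = solve 4 (λ b F W O → F :* W :* (b :* (con 1 :* O)) := b :* (W :* (F :* O))) refl
  ring₃ : ∀ W P F O → W * (P * (F * O)) ≡ F * P * (O * W)
  ring₃ = solve 4 (λ W P F O → W :* (P :* (F :* O)) := F :* P :* (O :* W)) refl
  f = E ∸ T j
  xs = replicate f 1 ++ powersOf2 1 j
  P = product (powersOf2 1 j)
  O = oddPart 1 j
  P≡ : product xs ≡ P
  P≡ = product-ones f _
  P⁺≡ : product (map suc xs) ≡ 2 ^ f * O
  P⁺≡ = product-suc-ones f _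
  2^E≡ : 2 ^ E ≡ 2 ^ f * P
  2^E≡ = trans (cong (2 ^_) (sym (m∸n+n≡m Tj≤E)))
               (trans (^-distribˡ-+-* 2 f (T j)) (cong (2 ^ f *_) (sym (product-powersOf2 j))))
  lo″ : W * product xs ≤ y
  lo″ = subst (_≤ y) (trans (cong (_* W) (sym (trans P≡ (product-powersOf2 j)))) (*-comm _ W)) lo
  hi″ : 2 ^ j * y < suc (2 ^ j) * (W * product (map suc xs))
  hi″ = begin-strict
    2 ^ j * y                                 <⟨ *-monoʳ-< (2 ^ j) {{m^n≢0 2 j}} hi ⟩
    2 ^ j * (2 * 2 ^ E * W)                   ≡⟨ cong (λ p → 2 ^ j * (2 * p * W)) 2^E≡ ⟩
    2 ^ j * (2 * (2 ^ f * P) * W)             ≡⟨ ring₁ (2 ^ j) (2 ^ f) P W ⟩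
    2 ^ f * W * (2 ^ j * (2 * P))             ≤⟨ *-monoʳ-≤ (2 ^ f * W) (proj₁ (balanced-powersOf2 j 0)) ⟩
    2 ^ f * W * (suc (2 ^ j) * (1 * O))       ≡⟨ ring₂ (suc (2 ^ j)) (2 ^ f) W O ⟩
    suc (2 ^ j) * (W * (2 ^ f * O))           ≡⟨ cong (λ p → suc (2 ^ j) * (W * p)) P⁺≡ ⟨
    suc (2 ^ j) * (W * product (map suc xs))  ∎
  divisor-bound : W * (product xs * product (map suc xs)) ≡ 2 ^ E * (O * W)
  divisor-bound = trans (cong₂ (λ p p⁺ → W * (p * p⁺)) P≡ P⁺≡)
                        (trans (ring₃ W P (2 ^ f) O) (cong (_* (O * W)) (sym 2^E≡)))

approx₁ : ∀ {E} j → T j ≤ E → DenseDivisors (2 ^ E * oddPart 1 j) (2 ^ j) (2 ^ T j) (2 ^ suc E)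
approx₁ {E} j Tj≤E = dense-weaken {a = 2 ^ j} (∣-reflexive (cong (2 ^ E *_) (*-identityʳ _)))
                       (≤-reflexive (*-identityʳ _)) (≤-reflexive (sym (*-identityʳ _))) (approx j 1 Tj≤E)

suc-double≤square : ∀ x → suc (2 * x) ≤ suc x ^ 2
suc-double≤square x = subst (suc (2 * x) ≤_) (expand x) (m≤m+n (suc (2 * x)) (x * x))
  where
  expand : ∀ x → suc (2 * x) + x * x ≡ suc x ^ 2
  expand = solve 1 (λ x → con 1 :+ con 2 :* x :+ x :* x := (con 1 :+ x) :^ 2) refl

suc-2^≤2^suc : ∀ n → suc (2 ^ n) ≤ 2 ^ suc n
suc-2^≤2^suc n = ≤-trans (+-monoˡ-≤ (2 ^ n) (m^n>0 2 n)) (≤-reflexive (cong (2 ^ n +_) (sym (+-identityʳ _))))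

Q : ℕ → ℕ → ℕ
Q h e = 2 ^ (e + T h) * oddPart 1 h

-- Greedy descent in three ranges: below 2 ^ T h, two steps of precision 2 ^ j cover each
-- [2 ^ T j, 2 ^ T (j + 1)); e + 1 steps of precision 2 ^ h reach 2 ^ (E + 1); above that the
-- factors 2^i + 1 with i > j are forced, and two steps of precision 2 ^ j absorb each of them.
module _ (h e : ℕ) where

  private
    E : ℕ
    E = e + T h

    T≤E : ∀ {j} → j ≤ h → T j ≤ E
    T≤E j≤h = ≤-trans (T-mono j≤h) (m≤n+m (T h) e)

  bottom : ∀ j → j ≤ h → ∀ y → y < 2 ^ T j → DivisorSum (Q h e) (2 * j) y
  bottom zero    _   y y<1 = subst (DivisorSum (Q h e) 0) (sym (n<1⇒n≡0 y<1)) empty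
    where
    empty : DivisorSum (Q h e) 0 0
    empty = record { divisors = [] ; descending = [] ; all∣Q = [] ; length≤ = z≤n ; sum≡ = refl }
  bottom (suc j) j<h y y<U = subst (λ n → DivisorSum (Q h e) n y) (two-more j)
    (greedy (m^n>0 2 j) dense (bottom j (<⇒≤ j<h)) 2 y y<U (<-≤-trans y<U growth))
    where
    open ≤-Reasoning
    two-more : ∀ j → 2 * j + 2 ≡ 2 * suc j
    two-more = solve 1 (λ j → con 2 :* j :+ con 2 := con 2 :* (con 1 :+ j)) refl
    dense : DenseDivisors (Q h e) (2 ^ j) (2 ^ T j) (2 ^ T (suc j))
    dense = dense-weaken {a = 2 ^ j} (*-monoʳ-∣ (2 ^ E) (oddPart-∣ (<⇒≤ j<h))) ≤-refl
                         (^-monoʳ-≤ 2 (m≤n⇒m≤1+n (T≤E j<h))) (approx₁ j (T≤E (<⇒≤ j<h)))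
    growth : 2 ^ T (suc j) ≤ 2 ^ T j * suc (2 ^ j) ^ 2
    growth = begin
      2 ^ (T j + suc j)          ≡⟨ ^-distribˡ-+-* 2 (T j) (suc j) ⟩
      2 ^ T j * (2 * 2 ^ j)      ≤⟨ *-monoʳ-≤ (2 ^ T j) (≤-trans (n≤1+n _) (suc-double≤square (2 ^ j))) ⟩
      2 ^ T j * suc (2 ^ j) ^ 2  ∎

  middle : ∀ y → y < 2 ^ suc E → DivisorSum (Q h e) (2 * h + suc e) y
  middle y y<U =
    greedy (m^n>0 2 h) (approx₁ h (T≤E ≤-refl)) (bottom h ≤-refl) (suc e) y y<U (<-≤-trans y<U growth)
    where
    open ≤-Reasoning
    growth : 2 ^ suc E ≤ 2 ^ T h * suc (2 ^ h) ^ suc e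
    growth = begin
      2 ^ (suc e + T h)              ≡⟨ ^-distribˡ-+-* 2 (suc e) (T h) ⟩
      2 ^ suc e * 2 ^ T h            ≤⟨ *-monoˡ-≤ (2 ^ T h) (^-monoˡ-≤ (suc e) (s≤s (m^n>0 2 h))) ⟩
      suc (2 ^ h) ^ suc e * 2 ^ T h  ≡⟨ *-comm _ (2 ^ T h) ⟩
      2 ^ T h * suc (2 ^ h) ^ suc e  ∎

  top : ∀ k j → j + k ≡ h → ∀ y → y < 2 ^ suc E * oddPart (suc j) k →
        DivisorSum (Q h e) (2 * h + suc e + 2 * k) y
  top zero    j _     y y<U = divisorSum-weaken (m≤m+n _ 0) (middle y (subst (y <_) (*-identityʳ _) y<U))
  top (suc k) j j+k≡h y y<U = subst (λ n → DivisorSum (Q h e) n y) (two-more (2 * h + suc e) k)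
    (greedy (m^n>0 2 j) dense (top k (suc j) (trans (sym (+-suc j k)) j+k≡h)) 2 y y<U (<-≤-trans y<U growth))
    where
    open ≤-Reasoning
    two-more : ∀ n k → n + 2 * k + 2 ≡ n + 2 * suc k
    two-more = solve 2 (λ n k → n :+ con 2 :* k :+ con 2 := n :+ con 2 :* (con 1 :+ k)) refl
    R = oddPart (suc (suc j)) k
    suc-j≤h : suc j ≤ h
    suc-j≤h = subst (suc j ≤_) j+k≡h (subst (_≤ j + suc k) (+-comm j 1) (+-monoʳ-≤ j (s≤s z≤n)))
    lower : 2 ^ T j * suc (2 ^ suc j) ≤ 2 ^ suc E
    lower = begin
      2 ^ T j * suc (2 ^ suc j)   ≤⟨ *-monoʳ-≤ (2 ^ T j) (suc-2^≤2^suc (suc j)) ⟩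
      2 ^ T j * 2 ^ suc (suc j)   ≡⟨ ^-distribˡ-+-* 2 (T j) (suc (suc j)) ⟨
      2 ^ (T j + suc (suc j))     ≡⟨ cong (2 ^_) (+-suc (T j) (suc j)) ⟩
      2 ^ suc (T (suc j))         ≤⟨ ^-monoʳ-≤ 2 (s≤s (T≤E suc-j≤h)) ⟩
      2 ^ suc E                   ∎
    dense : DenseDivisors (Q h e) (2 ^ j) (2 ^ suc E * R) (2 ^ suc E * oddPart (suc j) (suc k))
    dense = dense-weaken {a = 2 ^ j}
              (∣-reflexive (cong (2 ^ E *_) (trans (sym (oddPart-+ 1 j (suc k))) (cong (oddPart 1) j+k≡h))))
              (subst (_≤ 2 ^ suc E * R) (*-assoc (2 ^ T j) _ R) (*-monoˡ-≤ R lower))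
              ≤-refl
              (approx j (oddPart (suc j) (suc k)) (T≤E (≤-trans (n≤1+n j) suc-j≤h)))
    growth : 2 ^ suc E * oddPart (suc j) (suc k) ≤ 2 ^ suc E * R * suc (2 ^ j) ^ 2
    growth = begin
      2 ^ suc E * (suc (2 ^ suc j) * R)  ≤⟨ *-monoʳ-≤ (2 ^ suc E) (*-monoˡ-≤ R (suc-double≤square (2 ^ j))) ⟩
      2 ^ suc E * (suc (2 ^ j) ^ 2 * R)  ≡⟨ cong (2 ^ suc E *_) (*-comm _ R) ⟩
      2 ^ suc E * (R * suc (2 ^ j) ^ 2)  ≡⟨ *-assoc (2 ^ suc E) R _ ⟨
      2 ^ suc E * R * suc (2 ^ j) ^ 2    ∎

  divisorSum-below-2Q : ∀ y → y < 2 * Q h e → DivisorSum (Q h e) (4 * h + suc e) y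
  divisorSum-below-2Q y y<2Q = subst (λ n → DivisorSum (Q h e) n y) (count h e)
    (top h 0 refl y (subst (y <_) (sym (*-assoc 2 (2 ^ E) (oddPart 1 h))) y<2Q))
    where
    count : ∀ h e → 2 * h + suc e + 2 * h ≡ 4 * h + suc e
    count = solve 2 (λ h e → con 2 :* h :+ (con 1 :+ e) :+ con 2 :* h := con 4 :* h :+ (con 1 :+ e)) refl

-- M = M/2 + M/3 + M/6
proper-divisorSum-self : ∀ {M} → 1 ≤ M → 6 ∣ M → Σ (DivisorSum M 3 M) λ S → All (_< M) (divisors S)
proper-divisorSum-self _ (divides-refl R@(suc _)) =
  record { divisors   = R * 3 ∷ R * 2 ∷ R * 1 ∷ []
         ; descending = *-monoʳ-< R (≤-refl {3}) ∷ *-monoʳ-< R (≤-refl {2}) ∷ [-]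
         ; all∣Q      = *-monoʳ-∣ R (divides 2 refl) ∷ *-monoʳ-∣ R (divides 3 refl)
                        ∷ *-monoʳ-∣ R (divides 6 refl) ∷ []
         ; length≤    = ≤-refl
         ; sum≡       = solve 1 (λ R → R :* con 3 :+ (R :* con 2 :+ (R :* con 1 :+ con 0)) := R :* con 6) refl R }
  , *-monoʳ-< R (m≤m+n 4 2) ∷ *-monoʳ-< R (m≤m+n 3 3) ∷ *-monoʳ-< R (m≤m+n 2 4) ∷ []

6∣Q : ∀ h e → 6 ∣ Q (suc h) e
6∣Q h e = divides (2 ^ (e + (T h + h)) * oddPart 2 h) (begin
  2 ^ (e + (T h + suc h)) * (3 * oddPart 2 h)  ≡⟨ cong (λ x → 2 ^ x * (3 * oddPart 2 h))
                                                       (trans (cong (e +_) (+-suc (T h) h)) (+-suc e _)) ⟩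
  2 * 2 ^ (e + (T h + h)) * (3 * oddPart 2 h)  ≡⟨ regroup (2 ^ (e + (T h + h))) (oddPart 2 h) ⟩
  2 ^ (e + (T h + h)) * oddPart 2 h * 6        ∎)
  where
  open ≡-Reasoning
  regroup : ∀ a b → 2 * a * (3 * b) ≡ a * b * 6
  regroup = solve 2 (λ a b → con 2 :* a :* (con 3 :* b) := a :* b :* con 6) refl

2^≤Q : ∀ h e → 2 ^ (e + T h) ≤ Q h e
2^≤Q h e = m≤m*n (2 ^ (e + T h)) (oddPart 1 h) {{>-nonZero (oddPart-positive 1 h)}}

Q-positive : ∀ h e → 1 ≤ Q h e
Q-positive h e = ≤-trans (m^n>0 2 (e + T h)) (2^≤Q h e)

proper-divisorSum : ∀ h e y → y ≤ Q (suc h) e →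
                    Σ (DivisorSum (Q (suc h) e) (4 * suc h + suc e) y) λ S → All (_< Q (suc h) e) (divisors S)
proper-divisorSum h e y y≤Q with y <? Q (suc h) e
... | yes y<Q = S , All.map (λ x≤y → ≤-<-trans x≤y y<Q) (divisors-≤ S)
  where
  S = divisorSum-below-2Q (suc h) e y (<-≤-trans y<Q (m≤m+n _ _))
... | no  y≮Q rewrite ≤-antisym y≤Q (≮⇒≥ y≮Q) =
  let S , proper = proper-divisorSum-self (Q-positive (suc h) e) (6∣Q h e)
      3≤n = ≤-trans (≤-trans (n≤1+n 3) (*-monoʳ-≤ 4 (s≤s z≤n))) (m≤m+n (4 * suc h) (suc e))
  in divisorSum-weaken 3≤n S , proper

InD⁺-bracketed : ∀ h e {v} → Q (suc h) e < v → v ≤ 2 * Q (suc h) e → InD⁺ (2 * (4 * suc h + suc e) + 1) v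
InD⁺-bracketed h e {v} Q<v v≤2Q = subst (λ k → InD⁺ k v) (count (4 * suc h + suc e))
  (InD⁺-from-divisorSums (Q-positive (suc h) e) Q<v (proj₁ (proper-divisorSum h e (Q′ ∸ 1) (m∸n≤m Q′ 1)))
                         (proj₁ S₂) (proj₂ S₂))
  where
  Q′ = Q (suc h) e
  S₂ = proper-divisorSum h e (v ∸ Q′)
         (m≤n+o⇒m∸n≤o v Q′ (subst (v ≤_) (cong (Q′ +_) (+-identityʳ Q′)) v≤2Q))
  count : ∀ n → n + suc n ≡ 2 * n + 1
  count = solve 1 (λ n → n :+ (con 1 :+ n) := con 2 :* n :+ con 1) refl

crossing : ∀ (f : ℕ → ℕ) {m} b → f 0 < m → m ≤ f b → Σ ℕ λ i → f i < m × m ≤ f (suc i)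
crossing f zero        f0<m m≤f0   = ⊥-elim (<⇒≱ f0<m m≤f0)
crossing f {m} (suc b) f0<m m≤fb+1 with m ≤? f b
... | yes m≤fb = crossing f b f0<m m≤fb
... | no  m≰fb = b , ≰⇒> m≰fb , m≤fb+1

n<2^n : ∀ n → n < 2 ^ n
n<2^n zero    = s≤s z≤n
n<2^n (suc n) = ≤-<-trans (n<2^n n) (m<m+n (2 ^ n) (≤-trans (m^n>0 2 n) (m≤m+n _ 0)))

n≤T : ∀ n → n ≤ T n
n≤T zero    = z≤n
n≤T (suc n) = m≤n+m (suc n) (T n)

2*T : ∀ h → 2 * T h ≡ h * suc h
2*T zero    = refl
2*T (suc h) = trans (*-distribˡ-+ 2 (T h) (suc h)) (trans (cong (_+ 2 * suc h) (2*T h)) (step h))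
  where
  step : ∀ h → h * suc h + 2 * suc h ≡ suc h * suc (suc h)
  step = solve 1 (λ h → h :* (con 1 :+ h) :+ con 2 :* (con 1 :+ h) := (con 1 :+ h) :* (con 2 :+ h)) refl

Q-suc-e : ∀ h e → Q h (suc e) ≡ 2 * Q h e
Q-suc-e h e = *-assoc 2 (2 ^ (e + T h)) (oddPart 1 h)

Q-e : ∀ h e → Q h e ≡ 2 ^ e * Q h 0
Q-e h e = trans (cong (_* oddPart 1 h) (^-distribˡ-+-* 2 e (T h))) (*-assoc (2 ^ e) (2 ^ T h) (oddPart 1 h))

Q-suc-h : ∀ h → Q (suc h) 0 ≤ 2 ^ (2 * h + 3) * Q h 0
Q-suc-h h = begin
  2 ^ (T h + suc h) * oddPart 1 (suc h)        ≡⟨ cong₂ _*_ (^-distribˡ-+-* 2 (T h) (suc h)) split ⟩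
  2 ^ T h * 2 ^ suc h * (O * suc (2 ^ suc h))  ≤⟨ *-monoʳ-≤ (2 ^ T h * 2 ^ suc h) (*-monoʳ-≤ O (suc-2^≤2^suc (suc h))) ⟩
  2 ^ T h * 2 ^ suc h * (O * 2 ^ suc (suc h))  ≡⟨ regroup (2 ^ T h) (2 ^ suc h) O (2 ^ suc (suc h)) ⟩
  2 ^ suc h * 2 ^ suc (suc h) * (2 ^ T h * O)  ≡⟨ cong (_* (2 ^ T h * O)) (^-distribˡ-+-* 2 (suc h) (suc (suc h))) ⟨
  2 ^ (suc h + suc (suc h)) * Q h 0            ≡⟨ cong (λ n → 2 ^ n * Q h 0) (exponent h) ⟩
  2 ^ (2 * h + 3) * Q h 0                      ∎
  where
  open ≤-Reasoning
  O = oddPart 1 h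
  split : oddPart 1 (suc h) ≡ O * suc (2 ^ suc h)
  split = trans (cong (oddPart 1) (+-comm 1 h)) (trans (oddPart-+ 1 h 1) (cong (O *_) (*-identityʳ _)))
  exponent : ∀ h → suc h + suc (suc h) ≡ 2 * h + 3
  exponent = solve 1 (λ h → (con 1 :+ h) :+ (con 2 :+ h) := con 2 :* h :+ con 3) refl
  regroup : ∀ a b O c → a * b * (O * c) ≡ b * c * (a * O)
  regroup = solve 4 (λ a b O c → a :* b :* (O :* c) := b :* c :* (a :* O)) refl

^-cancelʳ-< : ∀ {m n} → 2 ^ m < 2 ^ n → m < n
^-cancelʳ-< {m} {n} 2^m<2^n with m <? n
... | yes m<n = m<n
... | no  m≮n = ⊥-elim (<⇒≱ 2^m<2^n (^-monoʳ-≤ 2 (≮⇒≥ m≮n)))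

bracket : ∀ {v} → 7 ≤ v → Σ ℕ λ h → Σ ℕ λ e →
          e < 2 * suc h + 3 × Q (suc h) e < v × v ≤ 2 * Q (suc h) e
bracket {v} 7≤v with crossing (λ h → Q h 0) v (≤-trans (s≤s (s≤s z≤n)) 7≤v) v≤Qv0
  where
  v≤Qv0 : v ≤ Q v 0
  v≤Qv0 = ≤-trans (<⇒≤ (n<2^n v)) (≤-trans (^-monoʳ-≤ 2 (n≤T v)) (2^≤Q v 0))
... | zero  , _   , v≤6    = ⊥-elim (<⇒≱ 7≤v v≤6)
... | suc h , Q₀<v , v≤Qₕ₊₁ with crossing (Q (suc h)) v Q₀<v v≤Qv
  where
  v≤Qv : v ≤ Q (suc h) v
  v≤Qv = ≤-trans (<⇒≤ (n<2^n v)) (≤-trans (^-monoʳ-≤ 2 (m≤m+n v _)) (2^≤Q (suc h) v))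
...   | e , Qₑ<v , v≤Qₑ₊₁ = h , e , e<2h+3 , Qₑ<v , subst (v ≤_) (Q-suc-e (suc h) e) v≤Qₑ₊₁
  where
  e<2h+3 : e < 2 * suc h + 3
  e<2h+3 = ^-cancelʳ-< (*-cancelʳ-< (Q (suc h) 0) _ _ (begin-strict
    2 ^ e * Q (suc h) 0                ≡⟨ Q-e (suc h) e ⟨
    Q (suc h) e                        <⟨ Qₑ<v ⟩
    v                                  ≤⟨ v≤Qₕ₊₁ ⟩
    Q (suc (suc h)) 0                  ≤⟨ Q-suc-h (suc h) ⟩
    2 ^ (2 * suc h + 3) * Q (suc h) 0  ∎))
    where open ≤-Reasoning

InS? : ∀ k ns → Dec (InS k ns)
InS? k ns = length ns ≟ k ×-dec all? (1 ≤?_) ns ×-dec linked? _<?_ ns ×-dec recipSum ns ℚ.≟ 1ℚ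

InD⁺-by-computation : ∀ {k} pre m y ys → True (InS? k (pre ++ m ∷ y ∷ ys)) → InD⁺ k m
InD⁺-by-computation pre m y ys ok = pre , y ∷ ys , toWitness ok , s≤s z≤n

small-entries : ∀ v → 1 < v → v < 7 → InD⁺ 4 v
small-entries 1 1<1 _ = ⊥-elim (<-irrefl refl 1<1)
small-entries 2 _   _ = InD⁺-by-computation [] 2 3 (7 ∷ 42 ∷ []) _
small-entries 3 _   _ = InD⁺-by-computation (2 ∷ []) 3 7 (42 ∷ []) _
small-entries 4 _   _ = InD⁺-by-computation (2 ∷ []) 4 6 (12 ∷ []) _
small-entries 5 _   _ = InD⁺-by-computation (2 ∷ 4 ∷ []) 5 20 [] _
small-entries 6 _   _ = InD⁺-by-computation (2 ∷ 4 ∷ []) 6 12 [] _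
small-entries (suc (suc (suc (suc (suc (suc (suc v))))))) _ v<7 = ⊥-elim (<⇒≱ v<7 (m≤m+n 7 v))

length-bound : ∀ {k v} → 1 < v → ¬ InD k v → Σ ℕ λ h → k ≤ 18 * h × 2 ^ T h ≤ v
length-bound {k} {v} 1<v v∉D with v <? 7 | 4 ≤? k
... | yes v<7 | yes 4≤k = ⊥-elim (v∉D (InD⁺⇒InD (InD⁺-mono 4≤k (small-entries v 1<v v<7))))
... | yes v<7 | no  4≰k = 1 , ≤-trans (≤-pred (≰⇒> 4≰k)) (m≤m+n 3 15) , 1<v
... | no  v≮7 | _       with bracket (≮⇒≥ v≮7)
...   | h , e , e<2h+3 , Q<v , v≤2Q with 2 * (4 * suc h + suc e) + 1 ≤? k
...     | yes long  = ⊥-elim (v∉D (InD⁺⇒InD (InD⁺-mono long (InD⁺-bracketed h e Q<v v≤2Q))))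
...     | no  short =
  suc h , k≤18h , ≤-trans (^-monoʳ-≤ 2 (m≤n+m (T (suc h)) e)) (≤-trans (2^≤Q (suc h) e) (<⇒≤ Q<v))
  where
  open ≤-Reasoning
  k≤18h : k ≤ 18 * suc h
  k≤18h = begin
    k                                          ≤⟨ ≤-pred (subst (k <_) (+-comm _ 1) (≰⇒> short)) ⟩
    2 * (4 * suc h + suc e)                    ≤⟨ *-monoʳ-≤ 2 (+-monoʳ-≤ (4 * suc h) e<2h+3) ⟩
    2 * (4 * suc h + (2 * suc h + 3))          ≤⟨ m≤m+n _ (6 * h) ⟩
    2 * (4 * suc h + (2 * suc h + 3)) + 6 * h  ≡⟨ arith h ⟩
    18 * suc h                                 ∎
    where
    arith : ∀ h → 2 * (4 * suc h + (2 * suc h + 3)) + 6 * h ≡ 18 * suc h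
    arith = solve 1 (λ h → con 2 :* (con 4 :* (con 1 :+ h) :+ (con 2 :* (con 1 :+ h) :+ con 3)) :+ con 6 :* h
                        := con 18 :* (con 1 :+ h)) refl

exponent-bound : ∀ h {k v} → k ≤ 18 * h → 2 ^ T h ≤ v → 2 ^ (k * k) ≤ v ^ 648
exponent-bound h {k} {v} k≤18h 2^Th≤v = begin
  2 ^ (k * k)      ≤⟨ ^-monoʳ-≤ 2 k²≤ ⟩
  2 ^ (T h * 648)  ≡⟨ ^-*-assoc 2 (T h) 648 ⟨
  (2 ^ T h) ^ 648  ≤⟨ ^-monoˡ-≤ 648 2^Th≤v ⟩
  v ^ 648          ∎
  where
  open ≤-Reasoning
  k²≤ : k * k ≤ T h * 648
  k²≤ = begin
    k * k              ≤⟨ *-mono-≤ k≤18h k≤18h ⟩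
    18 * h * (18 * h)  ≡⟨ solve 1 (λ h → con 18 :* h :* (con 18 :* h) := con 324 :* (h :* h)) refl h ⟩
    324 * (h * h)      ≤⟨ *-monoʳ-≤ 324 (*-monoʳ-≤ h (n≤1+n h)) ⟩
    324 * (h * suc h)  ≡⟨ cong (324 *_) (2*T h) ⟨
    324 * (2 * T h)    ≡⟨ solve 1 (λ t → con 324 :* (con 2 :* t) := t :* con 648) refl (T h) ⟩
    T h * 648          ∎

theorem1 : Σ ℕ λ N → (1 ≤ N) × (∀ k v → 1 ≤ k → IsV k v → 2 ^ (k * k) ≤ v ^ N)
theorem1 = 648 , s≤s z≤n , λ k v _ (1<v , v∉D , _) →
  let h , k≤18h , 2^Th≤v = length-bound 1<v v∉D in exponent-bound h k≤18h 2^Th≤v
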